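{- Let $n\ge 2$ and let $F(x_1,\dots,x_n)=\sum_{1\le i<j\le n} f_{ij}x_ix_j$ be a quadratic form with integer coefficients containing no diagonal terms (i.e. linear in each variable), whose coefficients have greatest common divisor $1$ and whose nonzero coefficients are pairwise coprime. Then for every $b\in\mathbb Z$ there exists $\mathbf a\in\mathbb Z^n$ such that $F(\mathbf a)=b$ and $$|\mathbf a|\le |b|+|F|^3.$$
   Context: $|\mathbf a|=\max_i|a_i|$ for $\mathbf a=(a_1,\dots,a_n)$, and $|F|=\max_{i<j}|f_{ij}|$. -}

module Defs where

open import Data.Nat as ℕ using (ℕ; _⊔_)
open import Data.Integer as ℤ using (ℤ; ∣_∣; _*_; _+_; 0ℤ)
open import Data.Integer.GCD using (gcd)
open import Data.Fin using (Fin; _<_)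
open import Data.Fin.Properties using (_<?_)
open import Data.List using (List; map; foldr; filter; allFin; cartesianProduct)
open import Data.Product using (_×_; _,_; proj₁; proj₂)

-- Coefficients of F are given by a function f : Fin n → Fin n → ℤ, of which
-- only the entries f i j with i < j are used (f_{ij}, 1 ≤ i < j ≤ n).
Coeffs : ℕ → Set
Coeffs n = Fin n → Fin n → ℤ

pairs : (n : ℕ) → List (Fin n × Fin n)
pairs n = filter (λ p → proj₁ p <? proj₂ p) (cartesianProduct (allFin n) (allFin n))

coeffAt : ∀ {n} → Coeffs n → Fin n × Fin n → ℤ
coeffAt f (i , j) = f i j

evalForm : ∀ {n} → Coeffs n → (Fin n → ℤ) → ℤ
evalForm {n} f a = foldr (λ p acc → coeffAt f p * a (proj₁ p) * a (proj₂ p) + acc) 0ℤ (pairs n)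

gcdCoeffs : ∀ {n} → Coeffs n → ℤ
gcdCoeffs {n} f = foldr (λ p g → gcd (coeffAt f p) g) 0ℤ (pairs n)

height : ∀ {n} → Coeffs n → ℕ
height {n} f = foldr (λ p m → ∣ coeffAt f p ∣ ⊔ m) 0 (pairs n)

supNorm : ∀ {n} → (Fin n → ℤ) → ℕ
supNorm {n} a = foldr (λ i m → ∣ a i ∣ ⊔ m) 0 (allFin n)

{-# OPTIONS --safe #-}
-- View the nonzero coefficients f_ij as edges {i, j} of a graph on the variables.
-- If two edges {i, k} and {j, k} share a vertex, their coefficients are coprime,
-- so there is a Bézout relation f_ik x + f_jk y = 1 with |x| ≤ |f_jk|, |y| ≤ |f_ik|;
-- with a_i = x, a_j = y and a_k = b - f_ij x y one gets
-- F(a) = f_ij x y + a_k (f_ik x + f_jk y) = b and |a_k| ≤ |b| + |F|³.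
-- Otherwise the edges form a matching.  Two disjoint edges {i, j}, {k, l} give
-- f_ij x + f_kl y = 1, and a = x e_i + y e_k + b e_j + b e_l works, all other
-- products a_r a_s having zero coefficient.  If there is only one edge, it carries
-- the gcd of all coefficients, so f_ij = ±1 and a = f_ij e_i + b e_j works.
module Submission where

open import Defs
open import Data.Bool using (true; false; if_then_else_)
open import Data.Empty using (⊥-elim)
open import Data.Fin as Fin using (Fin; zero; suc)
open import Data.Fin.Properties using (_≟_; _<?_; <-cmp; any?)
open import Data.Integer as ℤ using (ℤ; +_; +[1+_]; -[1+_]; ∣_∣; 0ℤ; 1ℤ; -1ℤ; _+_; _-_; _*_; -_)
import Data.Integer.Properties as ℤ
open import Algebra.Properties.Semiring.Sum ℤ.+-*-semiring
  using (sum; sum-cong-≗; ∑-distrib-+; sum-replicate-zero; *-distribʳ-sum)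
open import Data.Integer.GCD using (gcd)
open import Data.Integer.Tactic.RingSolver using (solve-∀)
open import Data.List using (List; []; _∷_; foldr; filter; map; _++_; tabulate; allFin; cartesianProduct)
open import Data.List.Membership.Propositional using (_∈_)
open import Data.List.Membership.Propositional.Properties
  using (∈-filter⁺; ∈-filter⁻; ∈-cartesianProduct⁺; ∈-allFin)
open import Data.List.Relation.Unary.All using (All; []; _∷_)
open import Data.List.Relation.Unary.Any using (here; there)
open import Data.List.Relation.Unary.Unique.Propositional using (Unique; []; _∷_)
open import Data.Nat as ℕ using (ℕ; zero; suc; NonZero; ≢-nonZero; _≤_; _<_; _⊔_; _^_)
import Data.Nat.Properties as ℕ
open import Data.Nat.Coprimality using (Coprime; coprime-Bézout; gcd≡1⇒coprime)
open import Data.Nat.Divisibility using (_∣_; _∣0; ∣-refl; 0∣⇒≡0; ∣1⇒≡1)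
open import Data.Nat.DivMod using (_/_; _%_; m≡m%n+[m/n]*n; m%n<n)
import Data.Nat.GCD as ℕ
open import Data.Nat.GCD using (module Bézout)
import Data.Nat.Tactic.RingSolver as ℕ-Solver
open import Data.Product using (Σ; ∃₂; _×_; _,_; proj₁; proj₂)
open import Data.Sum using (_⊎_; inj₁; inj₂)
open import Function using (_∘_)
open import Relation.Binary using (tri<; tri≈; tri>)
open import Relation.Binary.PropositionalEquality
open import Relation.Nullary using (Dec; does; yes; no; ¬?; _×-dec_)
open import Relation.Nullary.Decidable using (dec-true; dec-false; decidable-stable)

-- Bézout relations of bounded size

BoundedBézout : ℤ → ℤ → Set
BoundedBézout P Q = ∃₂ λ x y → P * x + Q * y ≡ 1ℤ × ∣ x ∣ ≤ ∣ Q ∣ × ∣ y ∣ ≤ ∣ P ∣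

bézout-reduce : ∀ {x y} β γ .{{_ : NonZero β}} .{{_ : NonZero γ}} → 1 ℕ.+ y ℕ.* γ ≡ x ℕ.* β →
  ∃₂ λ u v → u ≤ γ × v < β × 1 ℕ.+ v ℕ.* γ ≡ u ℕ.* β
bézout-reduce {x} {y} β γ eq = x ℕ.∸ q ℕ.* γ , r , u≤γ , m%n<n y β , sym reduced
  where
    r = y % β
    q = y / β
    reduced : (x ℕ.∸ q ℕ.* γ) ℕ.* β ≡ 1 ℕ.+ r ℕ.* γ
    reduced = begin
      (x ℕ.∸ q ℕ.* γ) ℕ.* β
        ≡⟨ ℕ.*-distribʳ-∸ β x (q ℕ.* γ) ⟩
      x ℕ.* β ℕ.∸ q ℕ.* γ ℕ.* β
        ≡⟨ cong (ℕ._∸ q ℕ.* γ ℕ.* β) (sym eq) ⟩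
      1 ℕ.+ y ℕ.* γ ℕ.∸ q ℕ.* γ ℕ.* β
        ≡⟨ cong (λ y → 1 ℕ.+ y ℕ.* γ ℕ.∸ q ℕ.* γ ℕ.* β) (m≡m%n+[m/n]*n y β) ⟩
      1 ℕ.+ (r ℕ.+ q ℕ.* β) ℕ.* γ ℕ.∸ q ℕ.* γ ℕ.* β
        ≡⟨ cong (ℕ._∸ q ℕ.* γ ℕ.* β) (expand r q β γ) ⟩
      1 ℕ.+ r ℕ.* γ ℕ.+ q ℕ.* γ ℕ.* β ℕ.∸ q ℕ.* γ ℕ.* β
        ≡⟨ ℕ.m+n∸n≡m (1 ℕ.+ r ℕ.* γ) (q ℕ.* γ ℕ.* β) ⟩
      1 ℕ.+ r ℕ.* γ ∎
      where
        open ≡-Reasoning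
        expand : ∀ r q β γ → 1 ℕ.+ (r ℕ.+ q ℕ.* β) ℕ.* γ ≡ 1 ℕ.+ r ℕ.* γ ℕ.+ q ℕ.* γ ℕ.* β
        expand = ℕ-Solver.solve-∀
    u≤γ : x ℕ.∸ q ℕ.* γ ≤ γ
    u≤γ = ℕ.*-cancelʳ-≤ _ γ β (begin
      (x ℕ.∸ q ℕ.* γ) ℕ.* β   ≡⟨ reduced ⟩
      1 ℕ.+ r ℕ.* γ           ≤⟨ ℕ.+-monoˡ-≤ (r ℕ.* γ) (ℕ.>-nonZero⁻¹ γ) ⟩
      suc r ℕ.* γ             ≤⟨ ℕ.*-monoˡ-≤ γ (m%n<n y β) ⟩
      β ℕ.* γ                 ≡⟨ ℕ.*-comm β γ ⟩
      γ ℕ.* β                 ∎)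
      where open ℕ.≤-Reasoning

ℕ-bézout⇒ℤ : ∀ {u v} β γ → 1 ℕ.+ v ℕ.* γ ≡ u ℕ.* β → + β * + u + + γ * - + v ≡ 1ℤ
ℕ-bézout⇒ℤ {u} {v} β γ eq = begin
  + β * + u + + γ * - + v            ≡⟨ rearrange (+ β) (+ u) (+ γ) (+ v) ⟩
  + u * + β - + v * + γ              ≡⟨ cong₂ _-_ (ℤ.pos-* u β) (ℤ.pos-* v γ) ⟨
  + (u ℕ.* β) - + (v ℕ.* γ)          ≡⟨ cong (λ w → + w - + (v ℕ.* γ)) eq ⟨
  + (1 ℕ.+ v ℕ.* γ) - + (v ℕ.* γ)    ≡⟨ cong (_- + (v ℕ.* γ)) (ℤ.pos-+ 1 (v ℕ.* γ)) ⟩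
  1ℤ + + (v ℕ.* γ) - + (v ℕ.* γ)     ≡⟨ cancel (+ (v ℕ.* γ)) ⟩
  1ℤ                                 ∎
  where
    open ≡-Reasoning
    rearrange : ∀ B U G V → B * U + G * - V ≡ U * B - V * G
    rearrange = solve-∀
    cancel : ∀ w → 1ℤ + w - w ≡ 1ℤ
    cancel = solve-∀

∣-i∣≤ : ∀ i {k} → ∣ i ∣ ≤ k → ∣ - i ∣ ≤ k
∣-i∣≤ i = subst (_≤ _) (sym (ℤ.∣-i∣≡∣i∣ i))

bézout-bounded-ℕ : ∀ β γ .{{_ : NonZero β}} .{{_ : NonZero γ}} → Coprime β γ → BoundedBézout (+ β) (+ γ)
bézout-bounded-ℕ β γ coprime with coprime-Bézout coprime
... | Bézout.+- x y eq with bézout-reduce {x} {y} β γ eq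
...   | u , v , u≤γ , v<β , eq′ =
  + u , - + v , ℕ-bézout⇒ℤ β γ eq′ , u≤γ , ∣-i∣≤ (+ v) (ℕ.<⇒≤ v<β)
bézout-bounded-ℕ β γ coprime | Bézout.-+ x y eq with bézout-reduce {y} {x} γ β eq
...   | u , v , u≤β , v<γ , eq′ =
  - + v , + u , trans (ℤ.+-comm (+ β * - + v) (+ γ * + u)) (ℕ-bézout⇒ℤ γ β eq′) ,
  ∣-i∣≤ (+ v) (ℕ.<⇒≤ v<γ) , u≤β

∣i∣≡1⇒i*i≡1 : ∀ {i} → ∣ i ∣ ≡ 1 → i * i ≡ 1ℤ
∣i∣≡1⇒i*i≡1 {+[1+ 0 ]}  refl = refl
∣i∣≡1⇒i*i≡1 { -[1+ 0 ]} refl = refl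

unit*∣i∣≡i : ∀ i → Σ ℤ λ s → ∣ s ∣ ≡ 1 × s * + ∣ i ∣ ≡ i
unit*∣i∣≡i (+ m)    = 1ℤ , refl , ℤ.*-identityˡ (+ m)
unit*∣i∣≡i -[1+ m ] = -1ℤ , refl , ℤ.-1*i≡-i (+ suc m)

∣unit*i∣ : ∀ {s} i → ∣ s ∣ ≡ 1 → ∣ s * i ∣ ≡ ∣ i ∣
∣unit*i∣ {s} i ∣s∣≡1 = trans (ℤ.abs-* s i) (trans (cong (ℕ._* ∣ i ∣) ∣s∣≡1) (ℕ.*-identityˡ ∣ i ∣))

∣i∣≢0 : ∀ {i} → i ≢ 0ℤ → ∣ i ∣ ≢ 0
∣i∣≢0 i≢0 = i≢0 ∘ ℤ.∣i∣≡0⇒i≡0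

bézout-bounded : ∀ {P Q} → P ≢ 0ℤ → Q ≢ 0ℤ → gcd P Q ≡ 1ℤ → BoundedBézout P Q
bézout-bounded {P} {Q} P≢0 Q≢0 gcd≡1
  with unit*∣i∣≡i P | unit*∣i∣≡i Q
     | bézout-bounded-ℕ ∣ P ∣ ∣ Q ∣ {{≢-nonZero (∣i∣≢0 P≢0)}} {{≢-nonZero (∣i∣≢0 Q≢0)}}
         (gcd≡1⇒coprime (ℤ.+-injective gcd≡1))
... | s , ∣s∣≡1 , sP≡P | t , ∣t∣≡1 , tQ≡Q | x , y , eq , ∣x∣≤ , ∣y∣≤ =
  s * x , t * y , identity ,
  subst (_≤ ∣ Q ∣) (sym (∣unit*i∣ {s} x ∣s∣≡1)) ∣x∣≤ ,
  subst (_≤ ∣ P ∣) (sym (∣unit*i∣ {t} y ∣t∣≡1)) ∣y∣≤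
  where
    open ≡-Reasoning
    regroup : ∀ s t A B x y → s * A * (s * x) + t * B * (t * y) ≡ (s * s) * (A * x) + (t * t) * (B * y)
    regroup = solve-∀
    identity : P * (s * x) + Q * (t * y) ≡ 1ℤ
    identity = begin
      P * (s * x) + Q * (t * y)
        ≡⟨ cong₂ (λ P Q → P * (s * x) + Q * (t * y)) sP≡P tQ≡Q ⟨
      s * + ∣ P ∣ * (s * x) + t * + ∣ Q ∣ * (t * y)
        ≡⟨ regroup s t (+ ∣ P ∣) (+ ∣ Q ∣) x y ⟩
      (s * s) * (+ ∣ P ∣ * x) + (t * t) * (+ ∣ Q ∣ * y)
        ≡⟨ cong₂ (λ a b → a * (+ ∣ P ∣ * x) + b * (+ ∣ Q ∣ * y))
                 (∣i∣≡1⇒i*i≡1 {s} ∣s∣≡1) (∣i∣≡1⇒i*i≡1 {t} ∣t∣≡1) ⟩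
      1ℤ * (+ ∣ P ∣ * x) + 1ℤ * (+ ∣ Q ∣ * y)
        ≡⟨ cong₂ _+_ (ℤ.*-identityˡ (+ ∣ P ∣ * x)) (ℤ.*-identityˡ (+ ∣ Q ∣ * y)) ⟩
      + ∣ P ∣ * x + + ∣ Q ∣ * y
        ≡⟨ eq ⟩
      1ℤ ∎

-- Finite sums and sparse vectors

private variable
  A B : Set
  n : ℕ

sumOver : (A → ℤ) → List A → ℤ
sumOver g = foldr (λ x acc → g x + acc) 0ℤ

sumOver-cong : ∀ {g h : A → ℤ} → g ≗ h → ∀ xs → sumOver g xs ≡ sumOver h xs
sumOver-cong g≗h []       = refl
sumOver-cong g≗h (x ∷ xs) = cong₂ _+_ (g≗h x) (sumOver-cong g≗h xs)

sumOver-zero : ∀ (xs : List A) → sumOver (λ _ → 0ℤ) xs ≡ 0ℤ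
sumOver-zero []       = refl
sumOver-zero (x ∷ xs) = trans (ℤ.+-identityˡ _) (sumOver-zero xs)

sumOver-++ : ∀ (g : A → ℤ) xs ys → sumOver g (xs ++ ys) ≡ sumOver g xs + sumOver g ys
sumOver-++ g []       ys = sym (ℤ.+-identityˡ _)
sumOver-++ g (x ∷ xs) ys = trans (cong (_+_ (g x)) (sumOver-++ g xs ys)) (sym (ℤ.+-assoc (g x) _ _))

sumOver-map : ∀ (g : B → ℤ) (h : A → B) xs → sumOver g (map h xs) ≡ sumOver (g ∘ h) xs
sumOver-map g h []       = refl
sumOver-map g h (x ∷ xs) = cong (_+_ (g (h x))) (sumOver-map g h xs)

sumOver-cartesianProduct : ∀ (g : A × B → ℤ) xs ys →
  sumOver g (cartesianProduct xs ys) ≡ sumOver (λ x → sumOver (λ y → g (x , y)) ys) xs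
sumOver-cartesianProduct g []       ys = refl
sumOver-cartesianProduct g (x ∷ xs) ys = begin
  sumOver g (map (x ,_) ys ++ cartesianProduct xs ys)
    ≡⟨ sumOver-++ g (map (x ,_) ys) (cartesianProduct xs ys) ⟩
  sumOver g (map (x ,_) ys) + sumOver g (cartesianProduct xs ys)
    ≡⟨ cong₂ _+_ (sumOver-map g (x ,_) ys) (sumOver-cartesianProduct g xs ys) ⟩
  sumOver (λ y → g (x , y)) ys + sumOver (λ x → sumOver (λ y → g (x , y)) ys) xs ∎
  where open ≡-Reasoning

sumOver-filter : ∀ {P : A → Set} (P? : ∀ x → Dec (P x)) (g : A → ℤ) xs →
  sumOver g (filter P? xs) ≡ sumOver (λ x → if does (P? x) then g x else 0ℤ) xs
sumOver-filter P? g []       = refl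
sumOver-filter P? g (x ∷ xs) with does (P? x)
... | true  = cong (_+_ (g x)) (sumOver-filter P? g xs)
... | false = trans (sumOver-filter P? g xs) (sym (ℤ.+-identityˡ _))

sumOver-tabulate : ∀ (g : A → ℤ) (h : Fin n → A) → sumOver g (tabulate h) ≡ sum (g ∘ h)
sumOver-tabulate {n = zero}  g h = refl
sumOver-tabulate {n = suc n} g h = cong (_+_ (g (h zero))) (sumOver-tabulate g (h ∘ suc))

sumOver-+ : ∀ (g h : A → ℤ) xs → sumOver (λ x → g x + h x) xs ≡ sumOver g xs + sumOver h xs
sumOver-+ g h []       = refl
sumOver-+ g h (x ∷ xs) = trans (cong (_+_ (g x + h x)) (sumOver-+ g h xs)) (interchange (g x) (h x) _ _)
  where
    interchange : ∀ a b c d → a + b + (c + d) ≡ a + c + (b + d)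
    interchange = solve-∀

sumOver-*ʳ : ∀ (g : A → ℤ) c xs → sumOver g xs * c ≡ sumOver (λ x → g x * c) xs
sumOver-*ʳ g c []       = ℤ.*-zeroˡ c
sumOver-*ʳ g c (x ∷ xs) = trans (ℤ.*-distribʳ-+ c (g x) _) (cong (_+_ (g x * c)) (sumOver-*ʳ g c xs))

pairSum : (A → A → ℤ) → List A → ℤ
pairSum w []       = 0ℤ
pairSum w (x ∷ xs) = sumOver (w x) xs + pairSum w xs

pairSum-cong : ∀ {v w : A → A → ℤ} → (∀ x y → v x y ≡ w x y) → ∀ xs → pairSum v xs ≡ pairSum w xs
pairSum-cong v≡w []       = refl
pairSum-cong v≡w (x ∷ xs) = cong₂ _+_ (sumOver-cong (v≡w x) xs) (pairSum-cong v≡w xs)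

sumOver-square : ∀ (w : A → A → ℤ) xs →
  sumOver (λ x → sumOver (w x) xs) xs ≡ sumOver (λ x → w x x) xs + pairSum (λ x y → w x y + w y x) xs
sumOver-square w []       = refl
sumOver-square w (x ∷ xs) = begin
  w x x + sumOver (w x) xs + sumOver (λ y → w y x + sumOver (w y) xs) xs
    ≡⟨ cong (_+_ (w x x + sumOver (w x) xs)) (sumOver-+ (λ y → w y x) (λ y → sumOver (w y) xs) xs) ⟩
  w x x + sumOver (w x) xs + (sumOver (λ y → w y x) xs + sumOver (λ y → sumOver (w y) xs) xs)
    ≡⟨ cong (λ r → w x x + sumOver (w x) xs + (sumOver (λ y → w y x) xs + r)) (sumOver-square w xs) ⟩
  w x x + sumOver (w x) xs + (sumOver (λ y → w y x) xs + (sumOver (λ y → w y y) xs + pairSum w′ xs))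
    ≡⟨ regroup (w x x) _ _ _ _ ⟩
  w x x + sumOver (λ y → w y y) xs + (sumOver (w x) xs + sumOver (λ y → w y x) xs + pairSum w′ xs)
    ≡⟨ cong (λ r → w x x + sumOver (λ y → w y y) xs + (r + pairSum w′ xs)) (sumOver-+ (w x) (λ y → w y x) xs) ⟨
  w x x + sumOver (λ y → w y y) xs + (sumOver (w′ x) xs + pairSum w′ xs) ∎
  where
    open ≡-Reasoning
    w′ = λ x y → w x y + w y x
    regroup : ∀ a b c d e → a + b + (c + (d + e)) ≡ a + d + (b + c + e)
    regroup = solve-∀

single : Fin n → ℤ → Fin n → ℤ
single s c i = if does (i ≟ s) then c else 0ℤ

∑-*-single : ∀ (g : Fin n → ℤ) s c → sum (λ i → g i * single s c i) ≡ g s * c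
∑-*-single {suc n} g zero c = begin
  g zero * c + sum (λ i → g (suc i) * 0ℤ)
    ≡⟨ cong (_+_ (g zero * c)) (trans (sum-cong-≗ (ℤ.*-zeroʳ ∘ g ∘ suc)) (sum-replicate-zero n)) ⟩
  g zero * c + 0ℤ
    ≡⟨ ℤ.+-identityʳ _ ⟩
  g zero * c ∎
  where open ≡-Reasoning
∑-*-single {suc n} g (suc s) c = begin
  g zero * 0ℤ + sum (λ i → g (suc i) * single s c i)
    ≡⟨ cong₂ _+_ (ℤ.*-zeroʳ (g zero)) (∑-*-single (g ∘ suc) s c) ⟩
  0ℤ + g (suc s) * c
    ≡⟨ ℤ.+-identityˡ _ ⟩
  g (suc s) * c ∎
  where open ≡-Reasoning

sparse : List (Fin n × ℤ) → Fin n → ℤ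
sparse L i = sumOver (λ p → single (proj₁ p) (proj₂ p) i) L

∑-*-sparse : ∀ (g : Fin n → ℤ) L → sum (λ i → g i * sparse L i) ≡ sumOver (λ p → g (proj₁ p) * proj₂ p) L
∑-*-sparse {n} g [] = trans (sum-cong-≗ (ℤ.*-zeroʳ ∘ g)) (sum-replicate-zero n)
∑-*-sparse g ((s , c) ∷ L) = begin
  sum (λ i → g i * (single s c i + sparse L i))
    ≡⟨ sum-cong-≗ (λ i → ℤ.*-distribˡ-+ (g i) (single s c i) (sparse L i)) ⟩
  sum (λ i → g i * single s c i + g i * sparse L i)
    ≡⟨ ∑-distrib-+ (λ i → g i * single s c i) (λ i → g i * sparse L i) ⟩
  sum (λ i → g i * single s c i) + sum (λ i → g i * sparse L i)
    ≡⟨ cong₂ _+_ (∑-*-single g s c) (∑-*-sparse g L) ⟩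
  g s * c + sumOver (λ p → g (proj₁ p) * proj₂ p) L ∎
  where open ≡-Reasoning

single-other : ∀ {s i : Fin n} c → i ≢ s → single s c i ≡ 0ℤ
single-other {s = s} {i} c i≢s = cong (if_then c else 0ℤ) (dec-false (i ≟ s) i≢s)

sparse-∉ : ∀ {s : Fin n} L → All (s ≢_) (map proj₁ L) → sparse L s ≡ 0ℤ
sparse-∉ []            []                = refl
sparse-∉ ((t , d) ∷ L) (s≢t ∷ s∉L) = trans (cong₂ _+_ (single-other d s≢t) (sparse-∉ L s∉L)) (ℤ.+-identityˡ _)

∣sparse∣≤ : ∀ {K} L → Unique (map proj₁ L) → All (λ c → ∣ c ∣ ≤ K) (map proj₂ L) →
  ∀ (i : Fin n) → ∣ sparse L i ∣ ≤ K
∣sparse∣≤ []            _               _               i = ℕ.z≤n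
∣sparse∣≤ ((s , c) ∷ L) (s∉L ∷ unique) (∣c∣≤K ∷ bounds) i with i ≟ s
... | yes refl = subst (λ v → ∣ v ∣ ≤ _) (sym (trans (cong (_+_ c) (sparse-∉ L s∉L)) (ℤ.+-identityʳ c)))
                   ∣c∣≤K
... | no _     = subst (λ v → ∣ v ∣ ≤ _) (sym (ℤ.+-identityˡ (sparse L i)))
                   (∣sparse∣≤ L unique bounds i)

∈⇒≤-foldr-⊔ : ∀ (g : A → ℕ) {x xs} → x ∈ xs → g x ≤ foldr (λ y m → g y ⊔ m) 0 xs
∈⇒≤-foldr-⊔ g (here refl) = ℕ.m≤m⊔n _ _
∈⇒≤-foldr-⊔ g (there x∈xs) = ℕ.≤-trans (∈⇒≤-foldr-⊔ g x∈xs) (ℕ.m≤n⊔m _ _)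

foldr-⊔-lub : ∀ (g : A → ℕ) {K} xs → (∀ x → g x ≤ K) → foldr (λ y m → g y ⊔ m) 0 xs ≤ K
foldr-⊔-lub g []       g≤K = ℕ.z≤n
foldr-⊔-lub g (x ∷ xs) g≤K = ℕ.⊔-lub (g≤K x) (foldr-⊔-lub g xs g≤K)

<⇒∈pairs : ∀ {i j : Fin n} → i Fin.< j → (i , j) ∈ pairs n
<⇒∈pairs i<j = ∈-filter⁺ (λ q → proj₁ q <? proj₂ q) (∈-cartesianProduct⁺ (∈-allFin _) (∈-allFin _)) i<j

∣-foldr-gcd : ∀ (g : A → ℤ) {d} xs → (∀ {x} → x ∈ xs → d ∣ ∣ g x ∣) →
  d ∣ ∣ foldr (λ x acc → gcd (g x) acc) 0ℤ xs ∣
∣-foldr-gcd g []       d∣ = _ ∣0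
∣-foldr-gcd g (x ∷ xs) d∣ = ℕ.gcd-greatest (d∣ (here refl)) (∣-foldr-gcd g xs (d∣ ∘ there))

-- The form and its coefficients

PairwiseCoprime : Coeffs n → Set
PairwiseCoprime {n} f = ∀ p q → p ∈ pairs n → q ∈ pairs n → p ≢ q
  → coeffAt f p ≢ 0ℤ → coeffAt f q ≢ 0ℤ → gcd (coeffAt f p) (coeffAt f q) ≡ 1ℤ

module Form {n : ℕ} (f : Coeffs n) where

  upper : Fin n → Fin n → ℤ
  upper i j = if does (i <? j) then f i j else 0ℤ

  coeff : Fin n → Fin n → ℤ
  coeff i j = upper i j + upper j i

  upper-diag : ∀ i → upper i i ≡ 0ℤ
  upper-diag i = cong (if_then f i i else 0ℤ) (dec-false (i <? i) (ℕ.<-irrefl refl))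

  coeff-diag : ∀ i → coeff i i ≡ 0ℤ
  coeff-diag i = cong₂ _+_ (upper-diag i) (upper-diag i)

  coeff-sym : ∀ i j → coeff i j ≡ coeff j i
  coeff-sym i j = ℤ.+-comm (upper i j) (upper j i)

  coeff≢0⇒≢ : ∀ {i j} → coeff i j ≢ 0ℤ → i ≢ j
  coeff≢0⇒≢ {i} ij≢0 refl = ij≢0 (coeff-diag i)

  coeff-< : ∀ {i j} → i Fin.< j → coeff i j ≡ f i j
  coeff-< {i} {j} i<j = begin
    upper i j + upper j i ≡⟨ cong₂ (λ u v → (if u then f i j else 0ℤ) + (if v then f j i else 0ℤ))
                                   (dec-true (i <? j) i<j) (dec-false (j <? i) (ℕ.<⇒≯ i<j)) ⟩
    f i j + 0ℤ            ≡⟨ ℤ.+-identityʳ (f i j) ⟩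
    f i j                 ∎
    where open ≡-Reasoning

  coeffAt≡coeff : ∀ {p} → p ∈ pairs n → coeffAt f p ≡ coeff (proj₁ p) (proj₂ p)
  coeffAt≡coeff p∈pairs =
    sym (coeff-< (proj₂ (∈-filter⁻ (λ q → proj₁ q <? proj₂ q)
                                   {xs = cartesianProduct (allFin n) (allFin n)} p∈pairs)))

  coeff-as-coeffAt : ∀ {i j} → coeff i j ≢ 0ℤ →
    Σ (Fin n × Fin n) λ p → p ∈ pairs n × coeffAt f p ≡ coeff i j × (p ≡ (i , j) ⊎ p ≡ (j , i))
  coeff-as-coeffAt {i} {j} ij≢0 with <-cmp i j
  ... | tri< i<j _ _ = (i , j) , <⇒∈pairs i<j , sym (coeff-< i<j) , inj₁ refl
  ... | tri≈ _ refl _ = ⊥-elim (ij≢0 (coeff-diag i))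
  ... | tri> _ _ j<i = (j , i) , <⇒∈pairs j<i , trans (sym (coeff-< j<i)) (coeff-sym j i) , inj₂ refl

  ∣coeff∣≤height : ∀ i j → ∣ coeff i j ∣ ≤ height f
  ∣coeff∣≤height i j with coeff i j ℤ.≟ 0ℤ
  ... | yes ij≡0 = subst (λ c → ∣ c ∣ ≤ height f) (sym ij≡0) ℕ.z≤n
  ... | no ij≢0 with coeff-as-coeffAt {i} {j} ij≢0
  ... | p , p∈pairs , p≡ij , _ =
    subst (λ c → ∣ c ∣ ≤ height f) p≡ij (∈⇒≤-foldr-⊔ (λ q → ∣ coeffAt f q ∣) p∈pairs)

  ∣gcdCoeffs : ∀ {d} → (∀ i j → d ∣ ∣ coeff i j ∣) → d ∣ ∣ gcdCoeffs f ∣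
  ∣gcdCoeffs d∣coeff = ∣-foldr-gcd (coeffAt f) (pairs n)
    (λ {p} p∈pairs → subst (λ c → _ ∣ ∣ c ∣) (sym (coeffAt≡coeff p∈pairs)) (d∣coeff (proj₁ p) (proj₂ p)))

  coeff-coprime : PairwiseCoprime f → ∀ {i j k l} → i ≢ k → i ≢ l →
    coeff i j ≢ 0ℤ → coeff k l ≢ 0ℤ → gcd (coeff i j) (coeff k l) ≡ 1ℤ
  coeff-coprime coprime {i} {j} {k} {l} i≢k i≢l ij≢0 kl≢0
    with coeff-as-coeffAt {i} {j} ij≢0 | coeff-as-coeffAt {k} {l} kl≢0
  ... | p , p∈pairs , p≡ij , p-ends | q , q∈pairs , q≡kl , q-ends =
    subst₂ (λ u v → gcd u v ≡ 1ℤ) p≡ij q≡kl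
      (coprime p q p∈pairs q∈pairs (distinct p-ends q-ends) (ij≢0 ∘ trans (sym p≡ij)) (kl≢0 ∘ trans (sym q≡kl)))
    where
      distinct : ∀ {p q} → p ≡ (i , j) ⊎ p ≡ (j , i) → q ≡ (k , l) ⊎ q ≡ (l , k) → p ≢ q
      distinct (inj₁ refl) (inj₁ refl) p≡q = i≢k (cong proj₁ p≡q)
      distinct (inj₁ refl) (inj₂ refl) p≡q = i≢l (cong proj₁ p≡q)
      distinct (inj₂ refl) (inj₁ refl) p≡q = i≢l (cong proj₂ p≡q)
      distinct (inj₂ refl) (inj₂ refl) p≡q = i≢k (cong proj₂ p≡q)

  crossTerms : List (Fin n × ℤ) → ℤ
  crossTerms = pairSum (λ p q → coeff (proj₁ p) (proj₁ q) * proj₂ p * proj₂ q)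

  evalForm≡∑∑ : ∀ a → evalForm f a ≡ sum (λ i → sum (λ j → upper i j * a j) * a i)
  evalForm≡∑∑ a = begin
    evalForm f a
      ≡⟨ sumOver-filter (λ p → proj₁ p <? proj₂ p) monomial (cartesianProduct (allFin n) (allFin n)) ⟩
    sumOver (λ p → term (proj₁ p) (proj₂ p)) (cartesianProduct (allFin n) (allFin n))
      ≡⟨ sumOver-cartesianProduct (λ p → term (proj₁ p) (proj₂ p)) (allFin n) (allFin n) ⟩
    sumOver (λ i → sumOver (term i) (allFin n)) (allFin n)
      ≡⟨ sumOver-tabulate (λ i → sumOver (term i) (allFin n)) (λ i → i) ⟩
    sum (λ i → sumOver (term i) (allFin n))
      ≡⟨ sum-cong-≗ (λ i → sumOver-tabulate (term i) (λ j → j)) ⟩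
    sum (λ i → sum (term i))
      ≡⟨ sum-cong-≗ (λ i → sum-cong-≗ (term≡ i)) ⟩
    sum (λ i → sum (λ j → upper i j * a j * a i))
      ≡⟨ sum-cong-≗ (λ i → *-distribʳ-sum (a i) (λ j → upper i j * a j)) ⟨
    sum (λ i → sum (λ j → upper i j * a j) * a i) ∎
    where
      open ≡-Reasoning
      monomial : Fin n × Fin n → ℤ
      monomial p = coeffAt f p * a (proj₁ p) * a (proj₂ p)
      term : Fin n → Fin n → ℤ
      term i j = if does (i <? j) then monomial (i , j) else 0ℤ
      swap : ∀ c x y → c * x * y ≡ c * y * x
      swap = solve-∀
      term≡ : ∀ i j → term i j ≡ upper i j * a j * a i
      term≡ i j with does (i <? j)
      ... | true  = swap (f i j) (a i) (a j)
      ... | false = sym (trans (cong (_* a i) (ℤ.*-zeroˡ (a j))) (ℤ.*-zeroˡ (a i)))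

  evalForm-sparse : ∀ L → evalForm f (sparse L) ≡ crossTerms L
  evalForm-sparse L = begin
    evalForm f a
      ≡⟨ evalForm≡∑∑ a ⟩
    sum (λ i → row i * a i)
      ≡⟨ ∑-*-sparse row L ⟩
    sumOver (λ p → row (proj₁ p) * proj₂ p) L
      ≡⟨ sumOver-cong (λ p → cong (_* proj₂ p) (∑-*-sparse (upper (proj₁ p)) L)) L ⟩
    sumOver (λ p → sumOver (λ q → upper (proj₁ p) (proj₁ q) * proj₂ q) L * proj₂ p) L
      ≡⟨ sumOver-cong (λ p → sumOver-*ʳ (λ q → upper (proj₁ p) (proj₁ q) * proj₂ q) (proj₂ p) L) L ⟩
    sumOver (λ p → sumOver (w p) L) L
      ≡⟨ sumOver-square w L ⟩
    sumOver (λ p → w p p) L + pairSum (λ p q → w p q + w q p) L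
      ≡⟨ cong₂ _+_ (trans (sumOver-cong w-diag L) (sumOver-zero L)) (pairSum-cong w-sym L) ⟩
    0ℤ + crossTerms L
      ≡⟨ ℤ.+-identityˡ _ ⟩
    crossTerms L ∎
    where
      open ≡-Reasoning
      a = sparse L
      row : Fin n → ℤ
      row i = sum (λ j → upper i j * a j)
      w : Fin n × ℤ → Fin n × ℤ → ℤ
      w (s , c) (t , d) = upper s t * d * c
      w-diag : ∀ p → w p p ≡ 0ℤ
      w-diag (s , c) = begin
        upper s s * c * c ≡⟨ cong (λ u → u * c * c) (upper-diag s) ⟩
        0ℤ * c * c        ≡⟨ cong (_* c) (ℤ.*-zeroˡ c) ⟩
        0ℤ * c            ≡⟨ ℤ.*-zeroˡ c ⟩
        0ℤ                ∎
      symmetrise : ∀ u v c d → u * d * c + v * c * d ≡ (u + v) * c * d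
      symmetrise = solve-∀
      w-sym : ∀ p q → w p q + w q p ≡ coeff (proj₁ p) (proj₁ q) * proj₂ p * proj₂ q
      w-sym (s , c) (t , d) = symmetrise (upper s t) (upper t s) c d

-- Representing b

n≤n^3 : ∀ h .{{_ : NonZero h}} → h ≤ h ^ 3
n≤n^3 h = ℕ.m≤m*n h (h ^ 2) {{ℕ.m^n≢0 h 2}}

∣i*j*k∣≤m^3 : ∀ {i j k m} → ∣ i ∣ ≤ m → ∣ j ∣ ≤ m → ∣ k ∣ ≤ m → ∣ i * j * k ∣ ≤ m ^ 3
∣i*j*k∣≤m^3 {i} {j} {k} {m} ∣i∣≤m ∣j∣≤m ∣k∣≤m = begin
  ∣ i * j * k ∣             ≡⟨ trans (ℤ.abs-* (i * j) k) (cong (ℕ._* ∣ k ∣) (ℤ.abs-* i j)) ⟩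
  ∣ i ∣ ℕ.* ∣ j ∣ ℕ.* ∣ k ∣  ≤⟨ ℕ.*-mono-≤ (ℕ.*-mono-≤ ∣i∣≤m ∣j∣≤m) ∣k∣≤m ⟩
  m ℕ.* m ℕ.* m             ≡⟨ ℕ.*-assoc m m m ⟩
  m ℕ.* (m ℕ.* m)           ≡⟨ cong (λ k → m ℕ.* (m ℕ.* k)) (ℕ.*-identityʳ m) ⟨
  m ^ 3                     ∎
  where open ℕ.≤-Reasoning

module Construction {n : ℕ} (f : Coeffs n) (b : ℤ) where
  open Form f

  bound : ℕ
  bound = ∣ b ∣ ℕ.+ height f ^ 3

  Representation : Set
  Representation = Σ (Fin n → ℤ) λ a → evalForm f a ≡ b × supNorm a ≤ bound

  sparse-representation : ∀ L → Unique (map proj₁ L) → All (λ c → ∣ c ∣ ≤ bound) (map proj₂ L) →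
    crossTerms L ≡ b → Representation
  sparse-representation L unique bounded value =
    sparse L , trans (evalForm-sparse L) value ,
    foldr-⊔-lub (λ i → ∣ sparse L i ∣) (allFin n) (∣sparse∣≤ L unique bounded)

  ∣b∣≤bound : ∣ b ∣ ≤ bound
  ∣b∣≤bound = ℕ.m≤m+n ∣ b ∣ _

  height≤bound : ∀ {i j} → coeff i j ≢ 0ℤ → height f ≤ bound
  height≤bound {i} {j} ij≢0 = ℕ.≤-trans (n≤n^3 (height f) {{≢-nonZero height≢0}}) (ℕ.m≤n+m _ ∣ b ∣)
    where
      height≢0 : height f ≢ 0
      height≢0 h≡0 = ∣i∣≢0 ij≢0 (ℕ.n≤0⇒n≡0 (subst (∣ coeff i j ∣ ≤_) h≡0 (∣coeff∣≤height i j)))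

  shared-variable : PairwiseCoprime f → ∀ {i j k} → i ≢ j → coeff i k ≢ 0ℤ → coeff j k ≢ 0ℤ → Representation
  shared-variable coprime {i} {j} {k} i≢j ik≢0 jk≢0 =
    from-bézout (bézout-bounded ik≢0 jk≢0 (coeff-coprime coprime {i} {k} {j} {k} i≢j i≢k ik≢0 jk≢0))
    where
      i≢k = coeff≢0⇒≢ {i} {k} ik≢0
      h≤bound = height≤bound {i} {k} ik≢0
      from-bézout : BoundedBézout (coeff i k) (coeff j k) → Representation
      from-bézout (x , y , bézout , ∣x∣≤ , ∣y∣≤) =
        sparse-representation ((i , x) ∷ (j , y) ∷ (k , z) ∷ [])
          ((i≢j ∷ i≢k ∷ []) ∷ (coeff≢0⇒≢ {j} {k} jk≢0 ∷ []) ∷ [] ∷ [])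
          (ℕ.≤-trans ∣x∣≤h h≤bound ∷ ℕ.≤-trans ∣y∣≤h h≤bound ∷ ∣z∣≤bound ∷ [])
          value
        where
          z = b - coeff i j * x * y
          ∣x∣≤h = ℕ.≤-trans ∣x∣≤ (∣coeff∣≤height j k)
          ∣y∣≤h = ℕ.≤-trans ∣y∣≤ (∣coeff∣≤height i k)
          ∣z∣≤bound : ∣ z ∣ ≤ bound
          ∣z∣≤bound = ℕ.≤-trans (ℤ.∣i-j∣≤∣i∣+∣j∣ b (coeff i j * x * y))
            (ℕ.+-monoʳ-≤ ∣ b ∣ (∣i*j*k∣≤m^3 {coeff i j} {x} {y} (∣coeff∣≤height i j) ∣x∣≤h ∣y∣≤h))
          collect : ∀ c P Q x y z →
            c * x * y + (P * x * z + 0ℤ) + (Q * y * z + 0ℤ + (0ℤ + 0ℤ)) ≡ c * x * y + (P * x + Q * y) * z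
          collect = solve-∀
          cancel : ∀ w b → w + 1ℤ * (b - w) ≡ b
          cancel = solve-∀
          open ≡-Reasoning
          -- the first line is crossTerms of the three-entry list, unfolded
          value = begin
            coeff i j * x * y + (coeff i k * x * z + 0ℤ) + (coeff j k * y * z + 0ℤ + (0ℤ + 0ℤ))
              ≡⟨ collect (coeff i j) (coeff i k) (coeff j k) x y z ⟩
            coeff i j * x * y + (coeff i k * x + coeff j k * y) * z
              ≡⟨ cong (λ t → coeff i j * x * y + t * z) bézout ⟩
            coeff i j * x * y + 1ℤ * z
              ≡⟨ cancel (coeff i j * x * y) b ⟩
            b ∎

  Matching : Set
  Matching = ∀ k {i j} → i ≢ j → coeff i k ≢ 0ℤ → coeff j k ≡ 0ℤ

  matchingˡ : Matching → ∀ k {i j} → i ≢ j → coeff k i ≢ 0ℤ → coeff k j ≡ 0ℤ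
  matchingˡ matching k {i} {j} i≢j ki≢0 = trans (coeff-sym k j) (matching k i≢j (ki≢0 ∘ trans (coeff-sym k i)))

  disjoint-edges : PairwiseCoprime f → Matching → ∀ {i j k l} →
    coeff i j ≢ 0ℤ → coeff k l ≢ 0ℤ → k ≢ i → k ≢ j → Representation
  disjoint-edges coprime matching {i} {j} {k} {l} ij≢0 kl≢0 k≢i k≢j =
    from-bézout (bézout-bounded ij≢0 kl≢0 (coeff-coprime coprime {i} {j} {k} {l} i≢k i≢l ij≢0 kl≢0))
    where
      i≢k : i ≢ k
      i≢k = k≢i ∘ sym
      ik≡0 : coeff i k ≡ 0ℤ
      ik≡0 = matchingˡ matching i (k≢j ∘ sym) ij≢0
      kj≡0 : coeff k j ≡ 0ℤ
      kj≡0 = matching j i≢k ij≢0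
      i≢l : i ≢ l
      i≢l refl = kl≢0 (trans (coeff-sym k i) ik≡0)
      j≢l : j ≢ l
      j≢l refl = kl≢0 kj≡0
      il≡0 : coeff i l ≡ 0ℤ
      il≡0 = matchingˡ matching i j≢l ij≢0
      jl≡0 : coeff j l ≡ 0ℤ
      jl≡0 = trans (coeff-sym j l) (matching j i≢l ij≢0)
      h≤bound = height≤bound {i} {j} ij≢0
      from-bézout : BoundedBézout (coeff i j) (coeff k l) → Representation
      from-bézout (x , y , bézout , ∣x∣≤ , ∣y∣≤) =
        sparse-representation ((i , x) ∷ (k , y) ∷ (j , b) ∷ (l , b) ∷ [])
          ((i≢k ∷ coeff≢0⇒≢ {i} {j} ij≢0 ∷ i≢l ∷ []) ∷ (k≢j ∷ coeff≢0⇒≢ {k} {l} kl≢0 ∷ []) ∷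
           (j≢l ∷ []) ∷ [] ∷ [])
          (ℕ.≤-trans (ℕ.≤-trans ∣x∣≤ (∣coeff∣≤height k l)) h≤bound ∷
           ℕ.≤-trans (ℕ.≤-trans ∣y∣≤ (∣coeff∣≤height i j)) h≤bound ∷ ∣b∣≤bound ∷ ∣b∣≤bound ∷ [])
          value
        where
          collect : ∀ {a c d e} P Q x y t → a ≡ 0ℤ → c ≡ 0ℤ → d ≡ 0ℤ → e ≡ 0ℤ →
            a * x * y + (P * x * t + (c * x * t + 0ℤ)) + (d * y * t + (Q * y * t + 0ℤ) + (e * t * t + 0ℤ + (0ℤ + 0ℤ)))
              ≡ (P * x + Q * y) * t
          collect P Q x y t refl refl refl refl = without-zeros P Q x y t
            where
              without-zeros : ∀ P Q x y t → 0ℤ * x * y + (P * x * t + (0ℤ * x * t + 0ℤ)) +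
                (0ℤ * y * t + (Q * y * t + 0ℤ) + (0ℤ * t * t + 0ℤ + (0ℤ + 0ℤ))) ≡ (P * x + Q * y) * t
              without-zeros = solve-∀
          value = trans (collect (coeff i j) (coeff k l) x y b ik≡0 il≡0 kj≡0 jl≡0)
                        (trans (cong (_* b) bézout) (ℤ.*-identityˡ b))

  unit-coefficient : ∀ {i j} → ∣ coeff i j ∣ ≡ 1 → Representation
  unit-coefficient {i} {j} ∣ij∣≡1 =
    sparse-representation ((i , coeff i j) ∷ (j , b) ∷ [])
      ((coeff≢0⇒≢ {i} {j} ij≢0 ∷ []) ∷ [] ∷ [])
      (ℕ.≤-trans (∣coeff∣≤height i j) (height≤bound {i} {j} ij≢0) ∷ ∣b∣≤bound ∷ [])
      value
    where
      ij≢0 : coeff i j ≢ 0ℤ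
      ij≢0 ij≡0 = ℕ.1+n≢0 (trans (sym ∣ij∣≡1) (cong ∣_∣ ij≡0))
      collect : ∀ c t → c * c * t + 0ℤ + (0ℤ + 0ℤ) ≡ c * c * t
      collect = solve-∀
      value = trans (collect (coeff i j) b)
                    (trans (cong (_* b) (∣i∣≡1⇒i*i≡1 {coeff i j} ∣ij∣≡1)) (ℤ.*-identityˡ b))

  only-edge-unit : gcdCoeffs f ≡ 1ℤ → Matching → ∀ {i j} → coeff i j ≢ 0ℤ →
    (∀ k l → coeff k l ≢ 0ℤ → k ≡ i ⊎ k ≡ j) → ∣ coeff i j ∣ ≡ 1
  only-edge-unit gcd≡1 matching {i} {j} ij≢0 endpoint =
    ∣1⇒≡1 (subst (λ g → ∣ coeff i j ∣ ∣ ∣ g ∣) gcd≡1 (∣gcdCoeffs divides))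
    where
      divides : ∀ k l → ∣ coeff i j ∣ ∣ ∣ coeff k l ∣
      divides k l with coeff k l ℤ.≟ 0ℤ
      ... | yes kl≡0 = subst (λ c → ∣ coeff i j ∣ ∣ ∣ c ∣) (sym kl≡0) (_ ∣0)
      ... | no kl≢0 with endpoint k l kl≢0 | l ≟ j | l ≟ i
      ...   | inj₁ refl | yes refl | _        = ∣-refl
      ...   | inj₁ refl | no l≢j   | _        = ⊥-elim (kl≢0 (matchingˡ matching i (l≢j ∘ sym) ij≢0))
      ...   | inj₂ refl | _        | yes refl = subst (λ c → ∣ coeff i j ∣ ∣ ∣ c ∣) (coeff-sym i j) ∣-refl
      ...   | inj₂ refl | _        | no l≢i   = ⊥-elim (kl≢0 (trans (coeff-sym j l) (matching j (l≢i ∘ sym) ij≢0)))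

  nonzero-coeff : gcdCoeffs f ≡ 1ℤ → Σ (Fin n) λ i → Σ (Fin n) λ j → coeff i j ≢ 0ℤ
  nonzero-coeff gcd≡1 with any? (λ i → any? (λ j → ¬? (coeff i j ℤ.≟ 0ℤ)))
  ... | yes (i , j , ij≢0) = i , j , ij≢0
  ... | no ¬nonzero = ⊥-elim (ℕ.1+n≢0 (0∣⇒≡0 (subst (λ g → 0 ∣ ∣ g ∣) gcd≡1 (∣gcdCoeffs 0∣coeff))))
    where
      0∣coeff : ∀ i j → 0 ∣ ∣ coeff i j ∣
      0∣coeff i j = subst (λ c → 0 ∣ ∣ c ∣)
        (sym (decidable-stable (coeff i j ℤ.≟ 0ℤ) (λ ij≢0 → ¬nonzero (i , j , ij≢0)))) (0 ∣0)

  matching-representation : PairwiseCoprime f → gcdCoeffs f ≡ 1ℤ → Matching → Representation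
  matching-representation coprime gcd≡1 matching with nonzero-coeff gcd≡1
  ... | i , j , ij≢0 with any? (λ k → any? (λ l → ¬? (k ≟ i) ×-dec ¬? (k ≟ j) ×-dec ¬? (coeff k l ℤ.≟ 0ℤ)))
  ...   | yes (k , l , k≢i , k≢j , kl≢0) = disjoint-edges coprime matching {l = l} ij≢0 kl≢0 k≢i k≢j
  ...   | no ¬other =
    unit-coefficient {i} {j} (only-edge-unit gcd≡1 matching ij≢0 endpoint)
    where
      endpoint : ∀ k l → coeff k l ≢ 0ℤ → k ≡ i ⊎ k ≡ j
      endpoint k l kl≢0 with k ≟ i | k ≟ j
      ... | yes k≡i | _       = inj₁ k≡i
      ... | no _    | yes k≡j = inj₂ k≡j
      ... | no k≢i  | no k≢j  = ⊥-elim (¬other (k , l , k≢i , k≢j , kl≢0))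

  representation : PairwiseCoprime f → gcdCoeffs f ≡ 1ℤ → Representation
  representation coprime gcd≡1
    with any? (λ i → any? (λ j → any? (λ k →
           ¬? (i ≟ j) ×-dec ¬? (coeff i k ℤ.≟ 0ℤ) ×-dec ¬? (coeff j k ℤ.≟ 0ℤ))))
  ... | yes (i , j , k , i≢j , ik≢0 , jk≢0) = shared-variable coprime {k = k} i≢j ik≢0 jk≢0
  ... | no ¬shared = matching-representation coprime gcd≡1 matching
    where
      matching : Matching
      matching k {i} {j} i≢j ik≢0 =
        decidable-stable (coeff j k ℤ.≟ 0ℤ) (λ jk≢0 → ¬shared (i , j , k , i≢j , ik≢0 , jk≢0))

proposition4 : (n : ℕ) → 2 ≤ n → (f : Coeffs n)
    → gcdCoeffs f ≡ 1ℤ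
    → (∀ p q → p ∈ pairs n → q ∈ pairs n → p ≢ q
         → coeffAt f p ≢ 0ℤ → coeffAt f q ≢ 0ℤ → gcd (coeffAt f p) (coeffAt f q) ≡ 1ℤ)
    → (b : ℤ) → Σ (Fin n → ℤ) (λ a → (evalForm f a ≡ b) × (supNorm a ≤ ∣ b ∣ ℕ.+ height f ^ 3))
proposition4 n _ f gcd≡1 coprime b = Construction.representation f b coprime gcd≡1
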